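{- If $\dot G\in\mathcal{C}_1\cup\mathcal{C}_4\cup\mathcal{C}_5$ is a connected, non-complete, $5$-regular and $1$ net-regular strongly regular signed graph with parameters $(n,5,a,b,c)$, then $(a,b)\neq(-2,1)$ and $(a,b)\neq(-2,-1)$.
   Context: A signed graph $\dot G=(G,\sigma)$ is a simple graph $G$ (its underlying graph) with a sign function $\sigma:E(G)\to\{+1,-1\}$; its adjacency matrix $A_{\dot G}$ has $(i,j)$ entry $\sigma(v_iv_j)$ if $v_i\sim v_j$ and $0$ otherwise. Degree is the degree in $G$; $d^\pm(v)$ are the numbers of positive/negative edges at $v$; the net-degree is $d^+(v)-d^-(v)$, and $\dot G$ is $\rho$ net-regular if all net-degrees equal $\rho$. Connected/complete refer to $G$. $\dot G$ is homogeneous if all edges have the same sign, inhomogeneous otherwise. A signed graph on $n$ vertices is strongly regular (SRSG) if it is neither homogeneous complete nor edgeless and there are $r\in\mathbb N$, $a,b,c\in\mathbb Z$ with $(A^2_{\dot G})_{ii}=r$, $(A^2_{\dot G})_{ij}=a$ for positive edges $v_iv_j$, $=b$ for negative edges, $=c$ for distinct non-adjacent $v_i,v_j$; parameters $(n,r,a,b,c)$. Inhomogeneous SRSGs are divided into classes: $\mathcal{C}_1$: $a=-b$, and either complete or non-complete with $c\neq 0$; $\mathcal{C}_4$: $a\neq -b$, non-complete with $c=0$; $\mathcal{C}_5$: $a\ne -b$, non-complete with $c\neq\frac{a+b}{2}$ and $c\neq 0$. -}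

module Defs where

open import Data.Nat using (ℕ; zero; suc)
open import Data.Integer using (ℤ; +_; -_; _+_; _-_; _*_)
open import Data.Integer.Properties using (_≟_)
open import Data.Fin using (Fin; zero; suc)
open import Data.Product using (_×_; ∃; ∃-syntax)
open import Data.Sum using (_⊎_)
open import Relation.Nullary using (¬_; yes; no)
open import Relation.Binary.PropositionalEquality using (_≡_; _≢_)

∑ : ∀ {n} → (Fin n → ℤ) → ℤ
∑ {zero}  f = + 0
∑ {suc n} f = f zero + ∑ (λ i → f (suc i))

countEq : ∀ {n} → (Fin n → ℤ) → ℤ → ℕ
countEq {zero}  f v = 0
countEq {suc n} f v with f zero ≟ v
... | yes _ = suc (countEq (λ i → f (suc i)) v)
... | no  _ = countEq (λ i → f (suc i)) v

record SignedGraph (n : ℕ) : Set where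
  field
    A     : Fin n → Fin n → ℤ
    entry : ∀ i j → (A i j ≡ + 0) ⊎ (A i j ≡ + 1) ⊎ (A i j ≡ - + 1)
    symm  : ∀ i j → A i j ≡ A j i
    loopless : ∀ i → A i i ≡ + 0
open SignedGraph public

module _ {n : ℕ} (G : SignedGraph n) where

  Adj : Fin n → Fin n → Set
  Adj i j = A G i j ≢ + 0

  PosEdge NegEdge : Fin n → Fin n → Set
  PosEdge i j = A G i j ≡ + 1
  NegEdge i j = A G i j ≡ - + 1

  A² : Fin n → Fin n → ℤ
  A² i j = ∑ (λ k → A G i k * A G k j)

  d⁺ d⁻ : Fin n → ℕ
  d⁺ v = countEq (A G v) (+ 1)
  d⁻ v = countEq (A G v) (- + 1)

  deg : Fin n → ℕ
  deg v = d⁺ v Data.Nat.+ d⁻ v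

  netDeg : Fin n → ℤ
  netDeg v = + d⁺ v - + d⁻ v

  Regular : ℕ → Set
  Regular k = ∀ v → deg v ≡ k

  NetRegular : ℤ → Set
  NetRegular ρ = ∀ v → netDeg v ≡ ρ

  data Reach : Fin n → Fin n → Set where
    here : ∀ {i} → Reach i i
    step : ∀ {i j k} → Adj i j → Reach j k → Reach i k

  Connected : Set
  Connected = ∀ i j → Reach i j

  Complete : Set
  Complete = ∀ i j → i ≢ j → Adj i j

  Edgeless : Set
  Edgeless = ∀ i j → A G i j ≡ + 0

  Homogeneous : Set
  Homogeneous = (∀ i j → ¬ NegEdge i j) ⊎ (∀ i j → ¬ PosEdge i j)

  Inhomogeneous : Set
  Inhomogeneous = ¬ Homogeneous

  record IsSRSG (r : ℕ) (a b c : ℤ) : Set where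
    field
      notHomComplete : ¬ (Homogeneous × Complete)
      notEdgeless    : ¬ Edgeless
      diag  : ∀ i → A² i i ≡ + r
      pos   : ∀ i j → PosEdge i j → A² i j ≡ a
      neg   : ∀ i j → NegEdge i j → A² i j ≡ b
      nonad : ∀ i j → i ≢ j → A G i j ≡ + 0 → A² i j ≡ c

  InC₁ : ℤ → ℤ → ℤ → Set
  InC₁ a b c = Inhomogeneous × a ≡ - b × (Complete ⊎ (¬ Complete × c ≢ + 0))

  InC₄ : ℤ → ℤ → ℤ → Set
  InC₄ a b c = Inhomogeneous × a ≢ - b × ¬ Complete × c ≡ + 0

  -- c ≠ (a+b)/2 written as 2c ≠ a + b
  InC₅ : ℤ → ℤ → ℤ → Set
  InC₅ a b c = Inhomogeneous × a ≢ - b × ¬ Complete × (+ 2 * c ≢ a + b) × c ≢ + 0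

-- Let x be the row of a vertex i and y the column of a positive neighbour j
-- of i. In a strongly regular signed graph, 2A² is a quadratic polynomial in
-- A applied entrywise plus a multiple of I; since A commutes with A² and with
-- J (net-regularity), the term (a + b − 2c)·A(A∘A) is symmetric, so
-- Σₖ xₖyₖ² = Σₖ xₖ²yₖ whenever a + b ≠ 2c. Counting the positions k by the
-- signs of (xₖ, yₖ), this together with Σₖ xₖyₖ = a = −2 and Σₖ xₖ² = 5
-- forces j to be adjacent to exactly one other positive neighbour of i. So
-- the positive neighbourhood of i is perfectly matched and d⁺(i) is even,
-- whereas 5-regularity and net-degree 1 give d⁺(i) = 3. For (a, b) = (−2, ±1)
-- the number a + b is odd, so indeed a + b ≠ 2c.

module Submission where

open import Defs
open import Data.Nat as ℕ using (ℕ; zero; suc)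
import Data.Nat.Properties as ℕ
import Data.Nat.Tactic.RingSolver as ℕ-Solver
open import Data.Nat.Divisibility using (_∣_; _∣?_; divides; m∣m*n; n∣m*n; ∣m∣n⇒∣m+n)
open import Data.Integer as ℤ using (ℤ; +_; -_; _+_; _-_; _*_; ∣_∣)
import Data.Integer.Properties as ℤ
open import Data.Integer.Tactic.RingSolver using (solve-∀)
open import Data.Fin using (Fin; zero; suc; punchIn)
open import Data.Fin.Properties using (punchInᵢ≢i)
open import Data.Bool using (if_then_else_)
open import Data.Product using (_×_; _,_; proj₁; proj₂)
open import Data.List using (_∷_; [])
open import Data.Sum using (_⊎_; inj₁; inj₂)
open import Function using (_∘_)
open import Relation.Nullary using (¬_; yes; no; does)
open import Relation.Nullary.Decidable using (from-no)
open import Relation.Binary.PropositionalEquality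
open import Algebra.Properties.AbelianGroup ℤ.+-0-abelianGroup using (∙-cancelˡ)
open import Algebra.Properties.CommutativeSemigroup ℕ.*-commutativeSemigroup using (x∙yz≈y∙xz)
import Algebra.Properties.Semiring.Sum as Sum
open Sum ℤ.+-*-semiring
module ℕ∑ = Sum ℕ.+-*-semiring

open ≡-Reasoning

∑≡sum : ∀ {n} (f : Fin n → ℤ) → ∑ f ≡ sum f
∑≡sum {zero}  f = refl
∑≡sum {suc n} f = cong (λ s → f zero + s) (∑≡sum (λ k → f (suc k)))

sum-pos : ∀ {n} (u : Fin n → ℕ) → sum (λ k → + u k) ≡ + ℕ∑.sum u
sum-pos {zero}  u = refl
sum-pos {suc n} u = cong (λ s → + u zero + s) (sum-pos (λ k → u (suc k)))

sum-neg : ∀ {n} (f : Fin n → ℤ) → sum (λ k → - f k) ≡ - sum f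
sum-neg {zero}  f = refl
sum-neg {suc n} f = begin
  - f zero + sum (λ k → - f (suc k))  ≡⟨ cong (λ s → - f zero + s) (sum-neg (λ k → f (suc k))) ⟩
  - f zero + - sum (λ k → f (suc k))  ≡⟨ ℤ.neg-distrib-+ (f zero) _ ⟨
  - sum f                             ∎

sum-pos-difference : ∀ {n} (u w : Fin n → ℕ) →
  sum (λ k → + u k - + w k) ≡ + ℕ∑.sum u - + ℕ∑.sum w
sum-pos-difference u w = begin
  sum (λ k → + u k - + w k)                ≡⟨ ∑-distrib-+ (λ k → + u k) (λ k → - + w k) ⟩
  sum (λ k → + u k) + sum (λ k → - + w k)  ≡⟨ cong₂ _+_ (sum-pos u) (sum-neg (λ k → + w k)) ⟩
  + ℕ∑.sum u - sum (λ k → + w k)           ≡⟨ cong (λ s → + ℕ∑.sum u - s) (sum-pos w) ⟩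
  + ℕ∑.sum u - + ℕ∑.sum w                  ∎

sum-point : ∀ {n} (f : Fin n → ℤ) j → (∀ k → k ≢ j → f k ≡ + 0) → sum f ≡ f j
sum-point {suc n} f j f≡0 = begin
  sum f                                ≡⟨ sum-remove {i = j} f ⟩
  f j + sum (λ k → f (punchIn j k))
    ≡⟨ cong (λ s → f j + s) (sum-cong-≗ (λ k → f≡0 _ (punchInᵢ≢i j k))) ⟩
  f j + sum {n} (λ _ → + 0)            ≡⟨ cong (λ s → f j + s) (sum-replicate-zero n) ⟩
  f j + + 0                            ≡⟨ ℤ.+-identityʳ (f j) ⟩
  f j                                  ∎

sum-agreeing-off : ∀ {n} (f g : Fin n → ℤ) j → (∀ k → k ≢ j → f k ≡ g k) →
  sum f ≡ sum g + (f j - g j)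
sum-agreeing-off f g j f≡g = begin
  sum f                          ≡⟨ sum-cong-≗ (λ k → split (f k) (g k)) ⟩
  sum (λ k → g k + (f k - g k))  ≡⟨ ∑-distrib-+ g (λ k → f k - g k) ⟩
  sum g + sum (λ k → f k - g k)
    ≡⟨ cong (λ s → sum g + s) (sum-point _ j (λ k k≢j → ℤ.i≡j⇒i-j≡0 (f≡g k k≢j))) ⟩
  sum g + (f j - g j)            ∎
  where
  split : ∀ u v → u ≡ v + (u - v)
  split = solve-∀

sum-quadratic : ∀ {n} (x y : Fin n → ℤ) p q r →
  sum (λ k → x k * (p + q * y k + r * (y k * y k)))
    ≡ p * sum x + q * sum (λ k → x k * y k) + r * sum (λ k → x k * (y k * y k))
sum-quadratic x y p q r = begin
  sum (λ k → x k * (p + q * y k + r * (y k * y k)))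
    ≡⟨ sum-cong-≗ (λ k → expand (x k) (y k) p q r) ⟩
  sum (λ k → p * x k + q * (x k * y k) + r * (x k * (y k * y k)))
    ≡⟨ ∑-distrib-+ (λ k → p * x k + q * (x k * y k)) (λ k → r * (x k * (y k * y k))) ⟩
  sum (λ k → p * x k + q * (x k * y k)) + sum (λ k → r * (x k * (y k * y k)))
    ≡⟨ cong (λ s → s + sum (λ k → r * (x k * (y k * y k))))
            (∑-distrib-+ (λ k → p * x k) (λ k → q * (x k * y k))) ⟩
  sum (λ k → p * x k) + sum (λ k → q * (x k * y k)) + sum (λ k → r * (x k * (y k * y k)))
    ≡⟨ cong₂ _+_ (cong₂ _+_ (*-distribˡ-sum p x) (*-distribˡ-sum q (λ k → x k * y k)))
                 (*-distribˡ-sum r (λ k → x k * (y k * y k))) ⟨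
  p * sum x + q * sum (λ k → x k * y k) + r * sum (λ k → x k * (y k * y k))
    ∎
  where
  expand : ∀ s t p q r → s * (p + q * t + r * (t * t)) ≡ p * s + q * (s * t) + r * (s * (t * t))
  expand = solve-∀

double : ∀ m → m ℕ.* 2 ≡ m ℕ.+ m
double = ℕ-Solver.solve-∀

∑∑-symmetric-even : ∀ {n} (g : Fin n → Fin n → ℕ) → (∀ j k → g j k ≡ g k j) →
  (∀ j → g j j ≡ 0) → 2 ∣ ℕ∑.sum (λ j → ℕ∑.sum (g j))
∑∑-symmetric-even {zero}  g _     _      = divides 0 refl
∑∑-symmetric-even {suc n} g g-sym g-diag = subst (2 ∣_) (sym split) (∣m∣n⇒∣m+n (n∣m*n R) rest-even)
  where
  R S : ℕ
  R = ℕ∑.sum (λ k → g zero (suc k))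
  S = ℕ∑.sum (λ j → ℕ∑.sum (λ k → g (suc j) (suc k)))
  rest-even : 2 ∣ S
  rest-even = ∑∑-symmetric-even (λ j k → g (suc j) (suc k))
                                (λ j k → g-sym (suc j) (suc k)) (g-diag ∘ suc)
  split : ℕ∑.sum (λ j → ℕ∑.sum (g j)) ≡ R ℕ.* 2 ℕ.+ S
  split = begin
    g zero zero ℕ.+ R ℕ.+ ℕ∑.sum (λ j → g (suc j) zero ℕ.+ ℕ∑.sum (λ k → g (suc j) (suc k)))
      ≡⟨ cong₂ (λ d s → d ℕ.+ R ℕ.+ s) (g-diag zero)
               (ℕ∑.∑-distrib-+ (λ j → g (suc j) zero) (λ j → ℕ∑.sum (λ k → g (suc j) (suc k)))) ⟩
    R ℕ.+ (ℕ∑.sum (λ j → g (suc j) zero) ℕ.+ S)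
      ≡⟨ cong (λ s → R ℕ.+ (s ℕ.+ S)) (ℕ∑.sum-cong-≗ (λ j → g-sym (suc j) zero)) ⟩
    R ℕ.+ (R ℕ.+ S)
      ≡⟨ ℕ.+-assoc R R S ⟨
    R ℕ.+ R ℕ.+ S
      ≡⟨ cong (ℕ._+ S) (double R) ⟨
    R ℕ.* 2 ℕ.+ S
      ∎

Matrix : ℕ → Set
Matrix n = Fin n → Fin n → ℤ

infixl 7 _∙_ _⊙_

_∙_ : ∀ {n} → Matrix n → Matrix n → Matrix n
(M ∙ N) i j = sum (λ k → M i k * N k j)

_⊙_ : ∀ {n} → Matrix n → Matrix n → Matrix n
(M ⊙ N) i j = M i j * N i j

Symmetric : ∀ {n} → Matrix n → Set
Symmetric M = ∀ i j → M i j ≡ M j i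

∙-assoc : ∀ {n} (L M N : Matrix n) i j → (L ∙ M ∙ N) i j ≡ (L ∙ (M ∙ N)) i j
∙-assoc L M N i j = begin
  sum (λ l → sum (λ k → L i k * M k l) * N l j)
    ≡⟨ sum-cong-≗ (λ l → *-distribʳ-sum (N l j) (λ k → L i k * M k l)) ⟩
  sum (λ l → sum (λ k → L i k * M k l * N l j))
    ≡⟨ ∑-comm (λ l k → L i k * M k l * N l j) ⟩
  sum (λ k → sum (λ l → L i k * M k l * N l j))
    ≡⟨ sum-cong-≗ (λ k → sum-cong-≗ (λ l → ℤ.*-assoc (L i k) (M k l) (N l j))) ⟩
  sum (λ k → sum (λ l → L i k * (M k l * N l j)))
    ≡⟨ sum-cong-≗ (λ k → *-distribˡ-sum (L i k) (λ l → M k l * N l j)) ⟨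
  sum (λ k → L i k * sum (λ l → M k l * N l j))
    ∎

∙-transpose : ∀ {n} {M N : Matrix n} → Symmetric M → Symmetric N →
  ∀ i j → (M ∙ N) i j ≡ (N ∙ M) j i
∙-transpose {M = M} {N} M-sym N-sym i j =
  sum-cong-≗ (λ k → trans (cong₂ _*_ (M-sym i k) (N-sym k j)) (ℤ.*-comm (M k i) (N j k)))

square-symmetric : ∀ {n} {M : Matrix n} → Symmetric M → Symmetric (M ∙ M)
square-symmetric M-sym = ∙-transpose M-sym M-sym

cube-symmetric : ∀ {n} {M : Matrix n} → Symmetric M → Symmetric (M ∙ (M ∙ M))
cube-symmetric {M = M} M-sym i j = begin
  (M ∙ (M ∙ M)) i j  ≡⟨ ∙-assoc M M M i j ⟨
  (M ∙ M ∙ M) i j    ≡⟨ ∙-transpose (square-symmetric M-sym) M-sym i j ⟩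
  (M ∙ (M ∙ M)) j i  ∎

𝟙[_≡_] : ℤ → ℤ → ℕ
𝟙[ x ≡ v ] = if does (x ℤ.≟ v) then 1 else 0

𝟙⁺ 𝟙⁻ 𝟙⁰ : ℤ → ℕ
𝟙⁺ x = 𝟙[ x ≡ + 1 ]
𝟙⁻ x = 𝟙[ x ≡ - + 1 ]
𝟙⁰ x = 𝟙[ x ≡ + 0 ]

countEq≡sum : ∀ {n} (f : Fin n → ℤ) v → countEq f v ≡ ℕ∑.sum (λ k → 𝟙[ f k ≡ v ])
countEq≡sum {zero}  f v = refl
countEq≡sum {suc n} f v with f zero ℤ.≟ v
... | yes _ = cong suc (countEq≡sum (λ k → f (suc k)) v)
... | no  _ = countEq≡sum (λ k → f (suc k)) v

Trit : ℤ → Set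
Trit x = (x ≡ + 0) ⊎ (x ≡ + 1) ⊎ (x ≡ - + 1)

trit-split : ∀ {x} → Trit x → x ≡ + 𝟙⁺ x - + 𝟙⁻ x
trit-split (inj₁ refl)        = refl
trit-split (inj₂ (inj₁ refl)) = refl
trit-split (inj₂ (inj₂ refl)) = refl

⁺⁺ ⁺⁻ ⁻⁺ ⁻⁻ ±⁰ : ℤ → ℤ → ℕ
⁺⁺ s t = 𝟙⁺ s ℕ.* 𝟙⁺ t
⁺⁻ s t = 𝟙⁺ s ℕ.* 𝟙⁻ t
⁻⁺ s t = 𝟙⁻ s ℕ.* 𝟙⁺ t
⁻⁻ s t = 𝟙⁻ s ℕ.* 𝟙⁻ t
±⁰ s t = ∣ s ∣ ℕ.* 𝟙⁰ t

record PatternIdentities (s t : ℤ) : Set where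
  constructor pattern-identities
  field
    xy   : s * t ≡ + (⁺⁺ s t ℕ.+ ⁻⁻ s t) - + (⁺⁻ s t ℕ.+ ⁻⁺ s t)
    xy²  : s * (t * t) ≡ + (⁺⁺ s t ℕ.+ ⁺⁻ s t) - + (⁻⁺ s t ℕ.+ ⁻⁻ s t)
    x²y  : s * s * t ≡ + (⁺⁺ s t ℕ.+ ⁻⁺ s t) - + (⁺⁻ s t ℕ.+ ⁻⁻ s t)
    x²   : s * s ≡ + (⁺⁺ s t ℕ.+ ⁺⁻ s t ℕ.+ ⁻⁺ s t ℕ.+ ⁻⁻ s t ℕ.+ ±⁰ s t)
    x⁺y² : 𝟙⁺ s ℕ.* ∣ t ∣ ≡ ⁺⁺ s t ℕ.+ ⁺⁻ s t

trit-pattern-identities : ∀ {s t} → Trit s → Trit t → PatternIdentities s t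
trit-pattern-identities (inj₁ refl)        (inj₁ refl)        = pattern-identities refl refl refl refl refl
trit-pattern-identities (inj₁ refl)        (inj₂ (inj₁ refl)) = pattern-identities refl refl refl refl refl
trit-pattern-identities (inj₁ refl)        (inj₂ (inj₂ refl)) = pattern-identities refl refl refl refl refl
trit-pattern-identities (inj₂ (inj₁ refl)) (inj₁ refl)        = pattern-identities refl refl refl refl refl
trit-pattern-identities (inj₂ (inj₁ refl)) (inj₂ (inj₁ refl)) = pattern-identities refl refl refl refl refl
trit-pattern-identities (inj₂ (inj₁ refl)) (inj₂ (inj₂ refl)) = pattern-identities refl refl refl refl refl
trit-pattern-identities (inj₂ (inj₂ refl)) (inj₁ refl)        = pattern-identities refl refl refl refl refl
trit-pattern-identities (inj₂ (inj₂ refl)) (inj₂ (inj₁ refl)) = pattern-identities refl refl refl refl refl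
trit-pattern-identities (inj₂ (inj₂ refl)) (inj₂ (inj₂ refl)) = pattern-identities refl refl refl refl refl

pos-difference-injective : ∀ p q r t → + p - + q ≡ + r - + t → p ℕ.+ t ≡ r ℕ.+ q
pos-difference-injective p q r t eq = ℤ.+-injective (begin
  + p + + t                  ≡⟨ shift (+ p) (+ q) (+ t) ⟩
  + p - + q + (+ q + + t)    ≡⟨ cong (λ s → s + (+ q + + t)) eq ⟩
  + r - + t + (+ q + + t)    ≡⟨ unshift (+ r) (+ q) (+ t) ⟩
  + r + + q                  ∎)
  where
  shift : ∀ u v w → u + w ≡ u - v + (v + w)
  shift = solve-∀
  unshift : ∀ u v w → u - w + (v + w) ≡ u + v
  unshift = solve-∀

2+s≡b*2∧b*2+s+e≡5⇒s≡0∧b≡1 : ∀ s b e →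
  2 ℕ.+ s ≡ b ℕ.* 2 → b ℕ.* 2 ℕ.+ s ℕ.+ e ≡ 5 → s ≡ 0 × b ≡ 1
2+s≡b*2∧b*2+s+e≡5⇒s≡0∧b≡1 s  0                   e () _
2+s≡b*2∧b*2+s+e≡5⇒s≡0∧b≡1 .0 1                   e refl _ = refl , refl
2+s≡b*2∧b*2+s+e≡5⇒s≡0∧b≡1 .2 2                   e refl ()
2+s≡b*2∧b*2+s+e≡5⇒s≡0∧b≡1 s  (suc (suc (suc b))) e _ ()

p+q≡5∧p-q≡1⇒p≡3 : ∀ {p q} → p ℕ.+ q ≡ 5 → + p - + q ≡ + 1 → p ≡ 3
p+q≡5∧p-q≡1⇒p≡3 {p} {q} p+q≡5 p-q≡1
  with trans (sym (ℕ.+-identityʳ p)) (pos-difference-injective p q 1 0 p-q≡1)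
... | refl = cong suc (ℕ.*-cancelʳ-≡ q 2 2 (trans (double q) (ℕ.suc-injective p+q≡5)))

-- α, β, γ, δ, ε: the numbers of positions with sign pattern (+,+), (+,−), (−,+), (−,−), (±,0).
count-arithmetic : ∀ {α β γ δ ε} → α ℕ.+ δ ℕ.+ 2 ≡ β ℕ.+ γ →
  α ℕ.+ β ℕ.+ (β ℕ.+ δ) ≡ α ℕ.+ γ ℕ.+ (γ ℕ.+ δ) →
  α ℕ.+ β ℕ.+ γ ℕ.+ δ ℕ.+ ε ≡ 5 → α ℕ.+ β ≡ 1
count-arithmetic {α} {β} {γ} {δ} {ε} e₁ e₂ e₃ =
  cong₂ ℕ._+_ (ℕ.m+n≡0⇒m≡0 α (proj₁ solution)) (proj₂ solution)
  where
  β≡γ : β ≡ γ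
  β≡γ = ℕ.*-cancelʳ-≡ β γ 2 (ℕ.+-cancelˡ-≡ (α ℕ.+ δ) _ _ (begin
    α ℕ.+ δ ℕ.+ β ℕ.* 2      ≡⟨ ℕ-Solver.solve (α ∷ β ∷ δ ∷ []) ⟩
    α ℕ.+ β ℕ.+ (β ℕ.+ δ)    ≡⟨ e₂ ⟩
    α ℕ.+ γ ℕ.+ (γ ℕ.+ δ)    ≡⟨ ℕ-Solver.solve (α ∷ γ ∷ δ ∷ []) ⟩
    α ℕ.+ δ ℕ.+ γ ℕ.* 2      ∎))
  solution : α ℕ.+ δ ≡ 0 × β ≡ 1
  solution = 2+s≡b*2∧b*2+s+e≡5⇒s≡0∧b≡1 (α ℕ.+ δ) β ε
    (begin
      2 ℕ.+ (α ℕ.+ δ)  ≡⟨ ℕ.+-comm 2 (α ℕ.+ δ) ⟩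
      α ℕ.+ δ ℕ.+ 2    ≡⟨ e₁ ⟩
      β ℕ.+ γ          ≡⟨ cong (β ℕ.+_) β≡γ ⟨
      β ℕ.+ β          ≡⟨ double β ⟨
      β ℕ.* 2          ∎)
    (begin
      β ℕ.* 2 ℕ.+ (α ℕ.+ δ) ℕ.+ ε    ≡⟨ ℕ-Solver.solve (α ∷ β ∷ δ ∷ ε ∷ []) ⟩
      α ℕ.+ β ℕ.+ β ℕ.+ δ ℕ.+ ε      ≡⟨ cong (λ g → α ℕ.+ β ℕ.+ g ℕ.+ δ ℕ.+ ε) β≡γ ⟩
      α ℕ.+ β ℕ.+ γ ℕ.+ δ ℕ.+ ε      ≡⟨ e₃ ⟩
      5                              ∎)

module _ {n} {x y : Fin n → ℤ} (x-trit : ∀ k → Trit (x k)) (y-trit : ∀ k → Trit (y k)) where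
  open PatternIdentities

  private
    at : (ℤ → ℤ → ℕ) → Fin n → ℕ
    at sign-pattern k = sign-pattern (x k) (y k)

    # : (ℤ → ℤ → ℕ) → ℕ
    # sign-pattern = ℕ∑.sum (at sign-pattern)

    identities : ∀ k → PatternIdentities (x k) (y k)
    identities k = trit-pattern-identities (x-trit k) (y-trit k)

    sum-by-patterns : ∀ {f : Fin n → ℤ} (u₁ u₂ w₁ w₂ : ℤ → ℤ → ℕ) →
      (∀ k → f k ≡ + (at u₁ k ℕ.+ at u₂ k) - + (at w₁ k ℕ.+ at w₂ k)) →
      sum f ≡ + (# u₁ ℕ.+ # u₂) - + (# w₁ ℕ.+ # w₂)
    sum-by-patterns {f} u₁ u₂ w₁ w₂ f≡ = begin
      sum f
        ≡⟨ sum-cong-≗ f≡ ⟩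
      sum (λ k → + (at u₁ k ℕ.+ at u₂ k) - + (at w₁ k ℕ.+ at w₂ k))
        ≡⟨ sum-pos-difference (λ k → at u₁ k ℕ.+ at u₂ k) (λ k → at w₁ k ℕ.+ at w₂ k) ⟩
      + ℕ∑.sum (λ k → at u₁ k ℕ.+ at u₂ k) - + ℕ∑.sum (λ k → at w₁ k ℕ.+ at w₂ k)
        ≡⟨ cong₂ (λ p q → + p - + q) (ℕ∑.∑-distrib-+ (at u₁) (at u₂))
                                      (ℕ∑.∑-distrib-+ (at w₁) (at w₂)) ⟩
      + (# u₁ ℕ.+ # u₂) - + (# w₁ ℕ.+ # w₂)
        ∎

    sum-x²-by-patterns : sum (λ k → x k * x k) ≡ + (# ⁺⁺ ℕ.+ # ⁺⁻ ℕ.+ # ⁻⁺ ℕ.+ # ⁻⁻ ℕ.+ # ±⁰)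
    sum-x²-by-patterns = begin
      sum (λ k → x k * x k)                ≡⟨ sum-cong-≗ (x² ∘ identities) ⟩
      sum (λ k → + (s₄ k ℕ.+ at ±⁰ k))     ≡⟨ sum-pos (λ k → s₄ k ℕ.+ at ±⁰ k) ⟩
      + ℕ∑.sum (λ k → s₄ k ℕ.+ at ±⁰ k)    ≡⟨ cong +_ (ℕ∑.∑-distrib-+ s₄ (at ±⁰)) ⟩
      + (ℕ∑.sum s₄ ℕ.+ # ±⁰)               ≡⟨ cong (λ t → + (t ℕ.+ # ±⁰)) Σs₄ ⟩
      + (# ⁺⁺ ℕ.+ # ⁺⁻ ℕ.+ # ⁻⁺ ℕ.+ # ⁻⁻ ℕ.+ # ±⁰) ∎
      where
      s₂ s₃ s₄ : Fin n → ℕ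
      s₂ k = at ⁺⁺ k ℕ.+ at ⁺⁻ k
      s₃ k = s₂ k ℕ.+ at ⁻⁺ k
      s₄ k = s₃ k ℕ.+ at ⁻⁻ k
      Σs₄ : ℕ∑.sum s₄ ≡ # ⁺⁺ ℕ.+ # ⁺⁻ ℕ.+ # ⁻⁺ ℕ.+ # ⁻⁻
      Σs₄ = begin
        ℕ∑.sum s₄                              ≡⟨ ℕ∑.∑-distrib-+ s₃ (at ⁻⁻) ⟩
        ℕ∑.sum s₃ ℕ.+ # ⁻⁻                     ≡⟨ cong (ℕ._+ # ⁻⁻) (ℕ∑.∑-distrib-+ s₂ (at ⁻⁺)) ⟩
        ℕ∑.sum s₂ ℕ.+ # ⁻⁺ ℕ.+ # ⁻⁻
          ≡⟨ cong (λ t → t ℕ.+ # ⁻⁺ ℕ.+ # ⁻⁻) (ℕ∑.∑-distrib-+ (at ⁺⁺) (at ⁺⁻)) ⟩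
        # ⁺⁺ ℕ.+ # ⁺⁻ ℕ.+ # ⁻⁺ ℕ.+ # ⁻⁻        ∎

  unique-common-positive :
    sum (λ k → x k * y k) ≡ - + 2 →
    sum (λ k → x k * (y k * y k)) ≡ sum (λ k → x k * x k * y k) →
    sum (λ k → x k * x k) ≡ + 5 →
    ℕ∑.sum (λ k → 𝟙⁺ (x k) ℕ.* ∣ y k ∣) ≡ 1
  unique-common-positive Σxy≡-2 Σxy²≡Σx²y Σx²≡5 = begin
    ℕ∑.sum (λ k → 𝟙⁺ (x k) ℕ.* ∣ y k ∣)  ≡⟨ ℕ∑.sum-cong-≗ (x⁺y² ∘ identities) ⟩
    ℕ∑.sum (λ k → at ⁺⁺ k ℕ.+ at ⁺⁻ k)   ≡⟨ ℕ∑.∑-distrib-+ (at ⁺⁺) (at ⁺⁻) ⟩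
    # ⁺⁺ ℕ.+ # ⁺⁻                        ≡⟨ count-arithmetic {# ⁺⁺} {# ⁺⁻} {# ⁻⁺} {# ⁻⁻} {# ±⁰}
                                                             e₁ e₂ e₃ ⟩
    1                                    ∎
    where
    e₁ : # ⁺⁺ ℕ.+ # ⁻⁻ ℕ.+ 2 ≡ # ⁺⁻ ℕ.+ # ⁻⁺
    e₁ = pos-difference-injective (# ⁺⁺ ℕ.+ # ⁻⁻) (# ⁺⁻ ℕ.+ # ⁻⁺) 0 2
      (trans (sym (sum-by-patterns ⁺⁺ ⁻⁻ ⁺⁻ ⁻⁺ (xy ∘ identities))) Σxy≡-2)
    e₂ : # ⁺⁺ ℕ.+ # ⁺⁻ ℕ.+ (# ⁺⁻ ℕ.+ # ⁻⁻) ≡ # ⁺⁺ ℕ.+ # ⁻⁺ ℕ.+ (# ⁻⁺ ℕ.+ # ⁻⁻)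
    e₂ = pos-difference-injective (# ⁺⁺ ℕ.+ # ⁺⁻) (# ⁻⁺ ℕ.+ # ⁻⁻) (# ⁺⁺ ℕ.+ # ⁻⁺) (# ⁺⁻ ℕ.+ # ⁻⁻)
      (begin
      + (# ⁺⁺ ℕ.+ # ⁺⁻) - + (# ⁻⁺ ℕ.+ # ⁻⁻)  ≡⟨ sum-by-patterns ⁺⁺ ⁺⁻ ⁻⁺ ⁻⁻ (xy² ∘ identities) ⟨
      sum (λ k → x k * (y k * y k))          ≡⟨ Σxy²≡Σx²y ⟩
      sum (λ k → x k * x k * y k)            ≡⟨ sum-by-patterns ⁺⁺ ⁻⁺ ⁺⁻ ⁻⁻ (x²y ∘ identities) ⟩
      + (# ⁺⁺ ℕ.+ # ⁻⁺) - + (# ⁺⁻ ℕ.+ # ⁻⁻)  ∎)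
    e₃ : # ⁺⁺ ℕ.+ # ⁺⁻ ℕ.+ # ⁻⁺ ℕ.+ # ⁻⁻ ℕ.+ # ±⁰ ≡ 5
    e₃ = ℤ.+-injective (trans (sym sum-x²-by-patterns) Σx²≡5)

module _ {n} (G : SignedGraph n) where

  A²≡A∙A : ∀ i j → A² G i j ≡ (A G ∙ A G) i j
  A²≡A∙A i j = ∑≡sum (λ k → A G i k * A G k j)

  A²-symmetric : Symmetric (A² G)
  A²-symmetric i j = begin
    A² G i j         ≡⟨ A²≡A∙A i j ⟩
    (A G ∙ A G) i j  ≡⟨ square-symmetric (symm G) i j ⟩
    (A G ∙ A G) j i  ≡⟨ A²≡A∙A j i ⟨
    A² G j i         ∎

  sum-row≡netDeg : ∀ i → sum (A G i) ≡ netDeg G i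
  sum-row≡netDeg i = begin
    sum (A G i)
      ≡⟨ sum-cong-≗ (λ k → trit-split (entry G i k)) ⟩
    sum (λ k → + 𝟙⁺ (A G i k) - + 𝟙⁻ (A G i k))
      ≡⟨ sum-pos-difference (𝟙⁺ ∘ A G i) (𝟙⁻ ∘ A G i) ⟩
    + ℕ∑.sum (𝟙⁺ ∘ A G i) - + ℕ∑.sum (𝟙⁻ ∘ A G i)
      ≡⟨ cong₂ (λ p q → + p - + q) (countEq≡sum (A G i) (+ 1)) (countEq≡sum (A G i) (- + 1)) ⟨
    netDeg G i
      ∎

  positive-degree : Regular G 5 → NetRegular G (+ 1) → ∀ i → d⁺ G i ≡ 3
  positive-degree reg net i = p+q≡5∧p-q≡1⇒p≡3 (reg i) (net i)

  even-positive-degree : ∀ i →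
    (∀ j → PosEdge G i j → ℕ∑.sum (λ k → 𝟙⁺ (A G i k) ℕ.* ∣ A G k j ∣) ≡ 1) → 2 ∣ d⁺ G i
  even-positive-degree i matched =
    subst (2 ∣_) count (∑∑-symmetric-even edge edge-symmetric edge-diagonal)
    where
    edge : Fin n → Fin n → ℕ
    edge j k = 𝟙⁺ (A G i j) ℕ.* (𝟙⁺ (A G i k) ℕ.* ∣ A G k j ∣)

    edge-symmetric : ∀ j k → edge j k ≡ edge k j
    edge-symmetric j k = trans (cong (λ t → 𝟙⁺ (A G i j) ℕ.* (𝟙⁺ (A G i k) ℕ.* ∣ t ∣)) (symm G k j))
                               (x∙yz≈y∙xz (𝟙⁺ (A G i j)) (𝟙⁺ (A G i k)) ∣ A G j k ∣)

    edge-diagonal : ∀ j → edge j j ≡ 0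
    edge-diagonal j rewrite loopless G j =
      trans (cong (𝟙⁺ (A G i j) ℕ.*_) (ℕ.*-zeroʳ (𝟙⁺ (A G i j)))) (ℕ.*-zeroʳ (𝟙⁺ (A G i j)))

    per-neighbour : ∀ j → 𝟙⁺ (A G i j) ℕ.* ℕ∑.sum (λ k → 𝟙⁺ (A G i k) ℕ.* ∣ A G k j ∣) ≡ 𝟙⁺ (A G i j)
    per-neighbour j with A G i j ℤ.≟ + 1
    ... | yes ij⁺ = trans (ℕ.+-identityʳ _) (matched j ij⁺)
    ... | no  _   = refl

    count : ℕ∑.sum (λ j → ℕ∑.sum (edge j)) ≡ d⁺ G i
    count = begin
      ℕ∑.sum (λ j → ℕ∑.sum (edge j))
        ≡⟨ ℕ∑.sum-cong-≗ (λ j →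
             ℕ∑.*-distribˡ-sum (𝟙⁺ (A G i j)) (λ k → 𝟙⁺ (A G i k) ℕ.* ∣ A G k j ∣)) ⟨
      ℕ∑.sum (λ j → 𝟙⁺ (A G i j) ℕ.* ℕ∑.sum (λ k → 𝟙⁺ (A G i k) ℕ.* ∣ A G k j ∣))
        ≡⟨ ℕ∑.sum-cong-≗ per-neighbour ⟩
      ℕ∑.sum (λ j → 𝟙⁺ (A G i j))
        ≡⟨ countEq≡sum (A G i) (+ 1) ⟨
      d⁺ G i
        ∎

  module _ {r a b c} (S : IsSRSG G r a b c) where
    open IsSRSG S

    -- Doubled so that the polynomial interpolating (c, a, b) at (0, 1, −1) has integer coefficients.
    twice-A²-offDiagonal : ∀ {i j} → i ≢ j →
      + 2 * A² G i j ≡ + 2 * c + (a - b) * A G i j + (a + b - + 2 * c) * (A G i j * A G i j)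
    twice-A²-offDiagonal {i} {j} i≢j with entry G i j
    ... | inj₁ e        rewrite e | nonad i j i≢j e = at-0 a b c
      where
      at-0 : ∀ a b c → + 2 * c ≡ + 2 * c + (a - b) * + 0 + (a + b - + 2 * c) * (+ 0 * + 0)
      at-0 = solve-∀
    ... | inj₂ (inj₁ e) rewrite e | pos i j e = at-1 a b c
      where
      at-1 : ∀ a b c → + 2 * a ≡ + 2 * c + (a - b) * + 1 + (a + b - + 2 * c) * (+ 1 * + 1)
      at-1 = solve-∀
    ... | inj₂ (inj₂ e) rewrite e | neg i j e = at-−1 a b c
      where
      at-−1 : ∀ a b c → + 2 * b ≡ + 2 * c + (a - b) * - + 1 + (a + b - + 2 * c) * (- + 1 * - + 1)
      at-−1 = solve-∀

    twice-A∙A² : ∀ {ρ} → NetRegular G ρ → ∀ i j →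
      + 2 * (A G ∙ (A G ∙ A G)) i j
        ≡ + 2 * c * ρ + (a - b) * A² G i j + (+ 2 * + r - + 2 * c) * A G i j
          + (a + b - + 2 * c) * (A G ∙ (A G ⊙ A G)) i j
    twice-A∙A² {ρ} net i j = begin
      + 2 * sum (λ k → x k * (A G ∙ A G) k j)
        ≡⟨ *-distribˡ-sum (+ 2) (λ k → x k * (A G ∙ A G) k j) ⟩
      sum (λ k → + 2 * (x k * (A G ∙ A G) k j))
        ≡⟨ sum-cong-≗ (λ k → trans (*-left-comm (+ 2) (x k) _)
                                   (cong (λ s → x k * (+ 2 * s)) (sym (A²≡A∙A k j)))) ⟩
      sum (λ k → x k * (+ 2 * A² G k j))
        ≡⟨ sum-agreeing-off _ (λ k → x k * q (A G k j)) j
             (λ k k≢j → cong (x k *_) (twice-A²-offDiagonal k≢j)) ⟩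
      sum (λ k → x k * q (A G k j)) + (x j * (+ 2 * A² G j j) - x j * q (A G j j))
        ≡⟨ cong₂ _+_ (sum-quadratic x (λ k → A G k j) (+ 2 * c) (a - b) γ)
                     (cong₂ (λ s t → x j * (+ 2 * s) - x j * q t) (diag j) (loopless G j)) ⟩
      + 2 * c * sum x + (a - b) * sum (λ k → x k * A G k j) + γ * X + (x j * (+ 2 * + r) - x j * q (+ 0))
        ≡⟨ cong₂ (λ s t → + 2 * c * s + (a - b) * t + γ * X + (x j * (+ 2 * + r) - x j * q (+ 0)))
                 (trans (sum-row≡netDeg i) (net i)) (sym (A²≡A∙A i j)) ⟩
      + 2 * c * ρ + (a - b) * A² G i j + γ * X + (x j * (+ 2 * + r) - x j * q (+ 0))
        ≡⟨ rearrange a b c (+ r) ρ (A² G i j) (x j) X ⟩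
      + 2 * c * ρ + (a - b) * A² G i j + (+ 2 * + r - + 2 * c) * x j + γ * X
        ∎
      where
      x : Fin n → ℤ
      x = A G i
      γ X : ℤ
      γ = a + b - + 2 * c
      X = (A G ∙ (A G ⊙ A G)) i j
      q : ℤ → ℤ
      q t = + 2 * c + (a - b) * t + γ * (t * t)
      *-left-comm : ∀ u v w → u * (v * w) ≡ v * (u * w)
      *-left-comm = solve-∀
      rearrange : ∀ a b c r ρ s t u →
        + 2 * c * ρ + (a - b) * s + (a + b - + 2 * c) * u
          + (t * (+ 2 * r) - t * (+ 2 * c + (a - b) * + 0 + (a + b - + 2 * c) * (+ 0 * + 0)))
        ≡ + 2 * c * ρ + (a - b) * s + (+ 2 * r - + 2 * c) * t + (a + b - + 2 * c) * u
      rearrange = solve-∀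

    A∙A⊙A-symmetric : ∀ {ρ} → NetRegular G ρ → a + b - + 2 * c ≢ + 0 →
      Symmetric (A G ∙ (A G ⊙ A G))
    A∙A⊙A-symmetric {ρ} net γ≢0 i j =
      ℤ.*-cancelˡ-≡ γ (X i j) (X j i) {{ℤ.≢-nonZero γ≢0}} (∙-cancelˡ (base i j) _ _ (begin
        base i j + γ * X i j                ≡⟨ twice-A∙A² net i j ⟨
        + 2 * (A G ∙ (A G ∙ A G)) i j       ≡⟨ cong (+ 2 *_) (cube-symmetric (symm G) i j) ⟩
        + 2 * (A G ∙ (A G ∙ A G)) j i       ≡⟨ twice-A∙A² net j i ⟩
        base j i + γ * X j i                ≡⟨ cong (λ s → s + γ * X j i) base-symmetric ⟨
        base i j + γ * X j i                ∎))
      where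
      γ : ℤ
      γ = a + b - + 2 * c
      X base : Matrix n
      X = A G ∙ (A G ⊙ A G)
      base k l = + 2 * c * ρ + (a - b) * A² G k l + (+ 2 * + r - + 2 * c) * A G k l
      base-symmetric : base i j ≡ base j i
      base-symmetric = cong₂ (λ s t → + 2 * c * ρ + (a - b) * s + (+ 2 * + r - + 2 * c) * t)
                             (A²-symmetric i j) (symm G i j)

module _ {n} (G : SignedGraph n) {a b c} (S : IsSRSG G 5 a b c) (net : NetRegular G (+ 1))
         (γ≢0 : a + b - + 2 * c ≢ + 0) (a≡-2 : a ≡ - + 2) where
  open IsSRSG S

  one-common-positive-neighbour : ∀ i j → PosEdge G i j →
    ℕ∑.sum (λ k → 𝟙⁺ (A G i k) ℕ.* ∣ A G k j ∣) ≡ 1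
  one-common-positive-neighbour i j ij⁺ =
    unique-common-positive (entry G i) (λ k → entry G k j) Σxy≡-2 Σxy²≡Σx²y Σx²≡5
    where
    Σxy≡-2 : sum (λ k → A G i k * A G k j) ≡ - + 2
    Σxy≡-2 = trans (sym (A²≡A∙A G i j)) (trans (pos i j ij⁺) a≡-2)

    Σxy²≡Σx²y : sum (λ k → A G i k * (A G k j * A G k j))
              ≡ sum (λ k → A G i k * A G i k * A G k j)
    Σxy²≡Σx²y = trans (A∙A⊙A-symmetric G S net γ≢0 i j) (sum-cong-≗ (λ k →
      trans (cong₂ (λ u v → u * (v * v)) (symm G j k) (symm G k i)) (ℤ.*-comm (A G k j) _)))

    Σx²≡5 : sum (λ k → A G i k * A G i k) ≡ + 5
    Σx²≡5 = trans (sum-cong-≗ (λ k → cong (A G i k *_) (symm G i k)))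
                  (trans (sym (A²≡A∙A G i i)) (diag i))

a≢-2 : ∀ {n} (G : SignedGraph n) {a b c} → IsSRSG G 5 a b c → Regular G 5 → NetRegular G (+ 1) →
  a + b - + 2 * c ≢ + 0 → a ≢ - + 2
a≢-2 {zero}  G S _   _   _   _    = IsSRSG.notEdgeless S (λ ())
a≢-2 {suc n} G S reg net γ≢0 a≡-2 =
  from-no (2 ∣? 3) (subst (2 ∣_) (positive-degree G reg net zero)
    (even-positive-degree G zero (one-common-positive-neighbour G S net γ≢0 a≡-2 zero)))

odd-sum⇒≢twice : ∀ {a b c} → ¬ 2 ∣ ∣ a + b ∣ → a + b - + 2 * c ≢ + 0
odd-sum⇒≢twice {a} {b} {c} odd a+b-2c≡0 = odd (subst (2 ∣_) (sym ∣a+b∣≡2∣c∣) (m∣m*n ∣ c ∣))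
  where
  ∣a+b∣≡2∣c∣ : ∣ a + b ∣ ≡ 2 ℕ.* ∣ c ∣
  ∣a+b∣≡2∣c∣ = trans (cong ∣_∣ (ℤ.i-j≡0⇒i≡j (a + b) (+ 2 * c) a+b-2c≡0)) (ℤ.abs-* (+ 2) c)

lemma3p10 : (n : ℕ) (G : SignedGraph n) (a b c : ℤ) →
    IsSRSG G 5 a b c →
    (InC₁ G a b c ⊎ InC₄ G a b c ⊎ InC₅ G a b c) →
    Connected G → ¬ Complete G → Regular G 5 → NetRegular G (+ 1) →
    ¬ (a ≡ - + 2 × b ≡ + 1) × ¬ (a ≡ - + 2 × b ≡ - + 1)
lemma3p10 n G a b c S _ _ _ reg net = excluded (from-no (2 ∣? 1)) , excluded (from-no (2 ∣? 3))
  where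
  excluded : ∀ {b′} → ¬ 2 ∣ ∣ - + 2 + b′ ∣ → ¬ (a ≡ - + 2 × b ≡ b′)
  excluded odd (a≡-2 , refl) =
    a≢-2 G S reg net (odd-sum⇒≢twice {a} {b} {c} (subst (λ a′ → ¬ 2 ∣ ∣ a′ + b ∣) (sym a≡-2) odd))
         a≡-2
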